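{- Let $k\geq 1$ be an integer. Let $G$ be a bracelet graph with parts $V_1, \ldots, V_m$, $m\geq 4$, such that $|V_i|\geq k$ for every $i$ and $|V_i|+|V_{i+2}|\geq 2k+1$ for every $i$ (indices modulo $m$). Then $G$ is $(2k+1)$-ordered.
   Context: A graph $G$ is a bracelet graph if its vertex set can be partitioned into nonempty sets $V_1, \ldots, V_m$ with $m\geq 3$ (called the parts) such that two vertices $u\in V_i$ and $v\in V_j$ are adjacent if and only if $i-j\equiv 1$ or $-1 \pmod m$. Parts $V_i$ and $V_{i+2}$ (indices mod $m$) are said to be at distance $2$. A simple graph $G$ is $r$-ordered if, for every sequence $v_1, \ldots, v_r$ of $r$ distinct vertices of $G$, there exists a cycle in $G$ containing $v_1, \ldots, v_r$ in this (cyclic) order. -}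

module Defs where

open import Data.Nat using (ℕ; zero; suc; _+_; _≤_; _<_)
open import Data.Fin using (Fin; toℕ)
open import Data.Fin.Properties using (_≟_)
open import Data.List using (List; length; filter; allFin)
open import Data.Product using (Σ; ∃; _×_)
open import Data.Sum using (_⊎_)
open import Data.Empty using (⊥)
open import Relation.Binary.PropositionalEquality using (_≡_)
open import Function.Definitions using (Injective)

record SimpleGraph (n : ℕ) : Set₁ where
  field
    Adj     : Fin n → Fin n → Set
    sym     : ∀ {u v} → Adj u v → Adj v u
    irrefl  : ∀ {u} → Adj u u → ⊥
open SimpleGraph public

CycSucc : ∀ {m} → Fin m → Fin m → Set
CycSucc {m} i j = toℕ j ≡ suc (toℕ i) ⊎ toℕ j + m ≡ suc (toℕ i)

CycPlus2 : ∀ {m} → Fin m → Fin m → Set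
CycPlus2 {m} i j = toℕ j ≡ suc (suc (toℕ i)) ⊎ toℕ j + m ≡ suc (suc (toℕ i))

CycNeighbour : ∀ {m} → Fin m → Fin m → Set
CycNeighbour i j = CycSucc i j ⊎ CycSucc j i

-- The map p : Fin n → Fin m assigns to each vertex its part; the part V_i is p⁻¹(i).
-- p is a bracelet partition of G (with m parts) iff every part is nonempty
-- and u ~ v iff their parts are cyclically consecutive.
IsBraceletPartition : ∀ {n} (m : ℕ) → SimpleGraph n → (Fin n → Fin m) → Set
IsBraceletPartition {n} m G p =
  3 ≤ m
  × (∀ (i : Fin m) → ∃ λ (v : Fin n) → p v ≡ i)
  × (∀ (u v : Fin n) → (Adj G u v → CycNeighbour (p u) (p v))
                     × (CycNeighbour (p u) (p v) → Adj G u v))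

partSize : ∀ {n m} → (Fin n → Fin m) → Fin m → ℕ
partSize {n} p i = length (filter (λ v → p v ≟ i) (allFin n))

record Cycle {n} (G : SimpleGraph n) : Set where
  field
    len     : ℕ
    len≥3   : 3 ≤ len
    vert    : Fin len → Fin n
    distinct : Injective _≡_ _≡_ vert
    edges   : ∀ (a b : Fin len) → CycSucc a b → Adj G (vert a) (vert b)
open Cycle public

-- The cycle C contains v 0, …, v (r-1) in this cyclic order: after choosing
-- a suitable starting point of C, they occur at strictly increasing positions.
ContainsInOrder : ∀ {n r} {G : SimpleGraph n} → Cycle G → (Fin r → Fin n) → Set
ContainsInOrder {r = r} C v =
  Σ (Fin r → Fin (len C)) λ t →
    (∀ (j : Fin r) → vert C (t j) ≡ v j)
    × (∀ (i j : Fin r) → toℕ i < toℕ j → toℕ (t i) < toℕ (t j))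

IsOrdered : ∀ {n} → ℕ → SimpleGraph n → Set
IsOrdered {n} r G =
  ∀ (v : Fin r → Fin n) → Injective _≡_ _≡_ v →
    Σ (Cycle G) λ C → ContainsInOrder C v

-- Induction on k, working with parts only: it suffices to find a closed walk in the cycle C_m of parts
-- that passes through p v₁, …, p v_{2k+1} in this cyclic order and enters every part V_i at most |V_i|
-- times, for then distinct vertices can be chosen greedily.  If all required vertices lie in one part a,
-- alternate between a and its two neighbour parts, whose sizes add up to at least 2k + 1.  Removing x and y and lowering every capacity by one leaves an instance for k − 1.  Its walk
-- is extended, right after the part u preceding x, by a detour through x and then y back to the next part
-- q of the walk that enters every part at most once: a round of C_m, or u w u q y₂ q when x = u and y = q,
-- which needs m ≥ 4.
module Submission where

open import Defs hiding (sym)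
open import Data.Nat using (ℕ; zero; suc; pred; _+_; _*_; _≤_; _<_; z≤n; s≤s; s≤s⁻¹; _≤?_)
open import Data.Nat.Properties
open import Data.Fin as Fin using (Fin; toℕ; inject₁; fromℕ; cast)
import Data.Fin.Properties as FinP
open import Data.List
  using (List; []; _∷_; _++_; [_]; length; filter; reverse; replicate; tabulate; allFin; lookup; map)
open import Data.List.Properties
  using ( ++-assoc; ++-identityʳ; length-++; length-map; length-replicate; length-tabulate; lookup-tabulate; map-++
        ; filter-++; filter-accept; filter-reject; filter-some; filter-none; unfold-reverse; reverse-++ )
open import Data.List.Relation.Unary.Linked as Linked using (Linked; []; [-]; _∷_)
import Data.List.Relation.Unary.Linked.Properties as Linked
open import Data.List.Relation.Unary.Any as Any using (here; there)
open import Data.List.Relation.Unary.All as All using (All; []; _∷_)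
import Data.List.Relation.Unary.All.Properties as All
open import Data.List.Membership.Propositional using (_∈_; _∉_; find)
open import Data.List.Membership.Propositional.Properties
  using (∈-allFin; ∈-lookup; ∈-filter⁺; ∈-filter⁻; ∈-∃++; ∈-++⁺ˡ; ∈-++⁺ʳ; ∈-++⁻)
open import Data.List.Relation.Unary.Unique.Propositional using (Unique; []; _∷_)
import Data.List.Relation.Unary.Unique.Propositional.Properties as Unique
open import Data.List.Relation.Binary.Sublist.Propositional using (_⊆_; []; _∷_; _∷ʳ_; minimum; from∈)
open import Data.List.Relation.Binary.Sublist.Propositional.Properties
  using (++⁺; ++⁺ˡ; ++⁺ʳ; length-mono-≤; filter⁺; reverse⁺; All-resp-⊆)
open import Data.List.Relation.Binary.Permutation.Propositional
  using (_↭_; ↭-refl; ↭-reflexive; ↭-sym; ↭-trans; prep; ↭⇒↭ₛ)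
open import Data.List.Relation.Binary.Permutation.Propositional.Properties
  using (↭-length; filter-↭; ++-comm; ∈-resp-↭; ↭-reverse; ∷↭∷ʳ; shift; shifts)
open import Data.Product using (Σ; ∃; ∃₂; _×_; _,_; proj₂)
open import Data.Sum as Sum using (_⊎_; inj₁; inj₂)
open import Data.Empty using (⊥-elim)
open import Data.Unit using (⊤; tt)
open import Function using (id; _∘_)
open import Relation.Nullary using (¬_; Dec; yes; no; ¬?; _×-dec_; _⊎-dec_; decidable-stable)
open import Relation.Binary.Definitions using (DecidableEquality)
open import Relation.Binary.PropositionalEquality
  using (_≡_; _≢_; refl; sym; trans; cong; cong₂; subst; subst₂; setoid; module ≡-Reasoning)
open import Relation.Binary.Construct.Closure.ReflexiveTransitive using (Star; ε; _◅_; _◅◅_)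

private
  variable
    A : Set
    R : A → A → Set
    x y : A
    xs ys zs : List A

-- Walks

linked-join : ∀ xs {y} zs → Linked R (xs ++ [ y ]) → Linked R (y ∷ zs) → Linked R (xs ++ y ∷ zs)
linked-join []            zs _        l = l
linked-join (_ ∷ [])      zs (r ∷ _)  l = r ∷ l
linked-join (_ ∷ x ∷ xs)  zs (r ∷ l′) l = r ∷ linked-join (x ∷ xs) zs l′ l

linked-split : ∀ xs {y} zs → Linked R (xs ++ y ∷ zs) → Linked R (xs ++ [ y ]) × Linked R (y ∷ zs)
linked-split []           zs l       = [-] , l
linked-split (_ ∷ [])     zs (r ∷ l) = r ∷ [-] , l
linked-split (_ ∷ x ∷ xs) zs (r ∷ l) with linked-split (x ∷ xs) zs l
... | l₁ , l₂ = r ∷ l₁ , l₂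

linked-last : ∀ xs {y z} → Linked R ((xs ++ [ y ]) ++ [ z ]) → R y z
linked-last []           (r ∷ _) = r
linked-last (_ ∷ [])     (_ ∷ l) = linked-last [] l
linked-last (_ ∷ x ∷ xs) (_ ∷ l) = linked-last (x ∷ xs) l

linked-reverse : (∀ {a b} → R a b → R b a) → Linked R xs → Linked R (reverse xs)
linked-reverse R-sym []  = []
linked-reverse R-sym [-] = [-]
linked-reverse {R = R} R-sym (_∷_ {x = x} {y} {xs} r l) =
  subst (Linked R) (sym reverse-∷∷) (linked-join (reverse xs) [ x ] reversed-tail (R-sym r ∷ [-]))
  where
  open ≡-Reasoning
  reversed-tail : Linked R (reverse xs ++ [ y ])
  reversed-tail = subst (Linked R) (unfold-reverse y xs) (linked-reverse R-sym l)
  reverse-∷∷ : reverse (x ∷ y ∷ xs) ≡ reverse xs ++ y ∷ [ x ]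
  reverse-∷∷ = begin
    reverse (x ∷ y ∷ xs)           ≡⟨ unfold-reverse x (y ∷ xs) ⟩
    reverse (y ∷ xs) ++ [ x ]      ≡⟨ cong (_++ [ x ]) (unfold-reverse y xs) ⟩
    (reverse xs ++ [ y ]) ++ [ x ] ≡⟨ ++-assoc (reverse xs) [ y ] [ x ] ⟩
    reverse xs ++ y ∷ [ x ]        ∎

linked-tabulate : ∀ {n} (f : Fin (suc n) → A) {z} → (∀ i → R (f (inject₁ i)) (f (Fin.suc i))) →
                  R (f (fromℕ n)) z → Linked R (tabulate f ++ [ z ])
linked-tabulate {n = zero}  f step last = last ∷ [-]
linked-tabulate {n = suc n} f step last = step Fin.zero ∷ linked-tabulate (f ∘ Fin.suc) (step ∘ Fin.suc) last

ClosedWalk : (A → A → Set) → List A → Set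
ClosedWalk R []       = ⊤
ClosedWalk R (x ∷ xs) = Linked R (x ∷ xs ++ [ x ])

closed-rotate : ∀ xs ys → ClosedWalk R (xs ++ ys) → ClosedWalk R (ys ++ xs)
closed-rotate []       ys c rewrite ++-identityʳ ys = c
closed-rotate (x ∷ xs) [] c rewrite ++-identityʳ xs = c
closed-rotate {R = R} (x ∷ xs) (y ∷ ys) c
  with linked-split (x ∷ xs) (ys ++ [ x ]) (subst (λ t → Linked R (x ∷ t)) (++-assoc xs (y ∷ ys) [ x ]) c)
... | l₁ , l₂ =
  subst (λ t → Linked R (y ∷ t)) (sym (++-assoc ys (x ∷ xs) [ y ])) (linked-join (y ∷ ys) (xs ++ [ y ]) l₂ l₁)

closed-pullback : ∀ {B : Set} {S : B → B → Set} {f : B → A} → (∀ {a b} → R (f a) (f b) → S a b) →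
                  ∀ xs → ClosedWalk R (map f xs) → ClosedWalk S xs
closed-pullback g []       _ = tt
closed-pullback {R = R} {f = f} g (x ∷ xs) c =
  Linked.map g (Linked.map⁻ (subst (Linked R) (cong (f x ∷_) (sym (map-++ f xs [ x ]))) c))

snoc-view : ∀ (x : A) xs → ∃₂ λ ys y → x ∷ xs ≡ ys ++ [ y ]
snoc-view x []       = [] , x , refl
snoc-view x (y ∷ xs) with snoc-view y xs
... | ys , z , eq = x ∷ ys , z , cong (x ∷_) eq

snoc-uncons : ∀ (xs : List A) x → ∃₂ λ y ys → xs ++ [ x ] ≡ y ∷ ys
snoc-uncons []       x = x , [] , refl
snoc-uncons (y ∷ xs) x = y , xs ++ [ x ] , refl

ends : 2 ≤ length xs → ∃₂ λ h l → ∃ λ M → xs ≡ h ∷ M ++ [ l ]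
ends {xs = _ ∷ []}     (s≤s ())
ends {xs = h ∷ x ∷ xs} _ with snoc-view x xs
... | M , l , eq = h , l , M , cong (h ∷_) eq

∈-tail : y ≢ x → y ∈ x ∷ xs → y ∈ xs
∈-tail y≢x (here y≡x) = ⊥-elim (y≢x y≡x)
∈-tail y≢x (there y∈) = y∈

all-≡-∈ : All (x ≡_) xs → y ∈ x ∷ xs → y ≡ x
all-≡-∈ _     (here y≡x) = y≡x
all-≡-∈ all≡x (there y∈) = sym (All.lookup all≡x y∈)

all-≡-replicate : All (x ≡_) xs → x ∷ xs ≡ replicate (suc (length xs)) x
all-≡-replicate         []            = refl
all-≡-replicate {x = x} (refl ∷ all≡) = cong (x ∷_) (all-≡-replicate all≡)

one-of-two : ∀ {a b c d : A} → c ≡ a ⊎ c ≡ b → d ≡ a ⊎ d ≡ b → c ≢ d →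
             ∀ {e} → e ≡ a ⊎ e ≡ b → e ≡ c ⊎ e ≡ d
one-of-two (inj₁ refl) _           _   (inj₁ refl) = inj₁ refl
one-of-two (inj₂ refl) _           _   (inj₂ refl) = inj₁ refl
one-of-two _           (inj₁ refl) _   (inj₁ refl) = inj₂ refl
one-of-two _           (inj₂ refl) _   (inj₂ refl) = inj₂ refl
one-of-two (inj₁ refl) (inj₁ refl) c≢d _           = ⊥-elim (c≢d refl)
one-of-two (inj₂ refl) (inj₂ refl) c≢d _           = ⊥-elim (c≢d refl)

⊆-∷-split : x ∷ xs ⊆ ys → ∃₂ λ ys₁ ys₂ → ys ≡ ys₁ ++ x ∷ ys₂ × xs ⊆ ys₂
⊆-∷-split (y ∷ʳ σ) with ⊆-∷-split σ
... | ys₁ , ys₂ , refl , τ = y ∷ ys₁ , ys₂ , refl , τ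
⊆-∷-split (refl ∷ σ) = [] , _ , refl , σ

⊆-++-split : ∀ xs → xs ++ ys ⊆ zs → ∃₂ λ zs₁ zs₂ → zs ≡ zs₁ ++ zs₂ × xs ⊆ zs₁ × ys ⊆ zs₂
⊆-++-split []       σ = [] , _ , refl , minimum _ , σ
⊆-++-split (x ∷ xs) σ with ⊆-∷-split σ
... | ys₁ , ys₂ , refl , τ with ⊆-++-split xs τ
...   | zs₁ , zs₂ , refl , τ₁ , τ₂ =
  ys₁ ++ x ∷ zs₁ , zs₂ , sym (++-assoc ys₁ (x ∷ zs₁) zs₂) , ++⁺ˡ ys₁ (refl ∷ τ₁) , τ₂

⊆-order : x ∈ xs → y ∈ xs → x ≢ y → x ∷ y ∷ [] ⊆ xs ⊎ y ∷ x ∷ [] ⊆ xs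
⊆-order (here refl) (here refl) x≢y = ⊥-elim (x≢y refl)
⊆-order (here refl) (there y∈) _    = inj₁ (refl ∷ from∈ y∈)
⊆-order (there x∈)  (here refl) _   = inj₂ (refl ∷ from∈ x∈)
⊆-order {xs = z ∷ _} (there x∈) (there y∈) x≢y with ⊆-order x∈ y∈ x≢y
... | inj₁ σ = inj₁ (z ∷ʳ σ)
... | inj₂ σ = inj₂ (z ∷ʳ σ)

embed : xs ⊆ ys → Fin (length xs) → Fin (length ys)
embed (_ ∷ʳ σ) i           = Fin.suc (embed σ i)
embed (_ ∷ σ)  Fin.zero    = Fin.zero
embed (_ ∷ σ)  (Fin.suc i) = Fin.suc (embed σ i)

lookup-embed : (σ : xs ⊆ ys) → ∀ i → lookup ys (embed σ i) ≡ lookup xs i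
lookup-embed (_ ∷ʳ σ)   i           = lookup-embed σ i
lookup-embed (refl ∷ σ) Fin.zero    = refl
lookup-embed (refl ∷ σ) (Fin.suc i) = lookup-embed σ i

embed-mono : (σ : xs ⊆ ys) → ∀ {i j} → toℕ i < toℕ j → toℕ (embed σ i) < toℕ (embed σ j)
embed-mono (_ ∷ʳ σ) i<j                               = s≤s (embed-mono σ i<j)
embed-mono (_ ∷ σ)  {Fin.zero}  {Fin.suc j} _         = s≤s z≤n
embed-mono (_ ∷ σ)  {Fin.suc i} {Fin.suc j} (s≤s i<j) = s≤s (embed-mono σ i<j)

unique-⊆ : xs ⊆ ys → Unique ys → Unique xs
unique-⊆ []         []       = []
unique-⊆ (_ ∷ʳ σ)   (_ ∷ u)  = unique-⊆ σ u
unique-⊆ (refl ∷ σ) (x∉ ∷ u) = All-resp-⊆ σ x∉ ∷ unique-⊆ σ u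

unique-↭ : ∀ {A : Set} {xs ys : List A} → xs ↭ ys → Unique xs → Unique ys
unique-↭ {A = A} p = Unique-resp-↭ (↭⇒↭ₛ p)
  where open import Data.List.Relation.Binary.Permutation.Setoid.Properties (setoid A) using (Unique-resp-↭)

unique-length-≤ : Unique xs → (∀ {z} → z ∈ xs → z ∈ ys) → length xs ≤ length ys
unique-length-≤ []                   _   = z≤n
unique-length-≤ {ys = ys} (x∉xs ∷ u) sub with ∈-∃++ (sub (here refl))
... | ys₁ , ys₂ , refl = subst (_ ≤_) (length-insert ys₁) (s≤s (unique-length-≤ u sub′))
  where
  length-insert : ∀ zs₁ {z zs₂} → suc (length (zs₁ ++ zs₂)) ≡ length (zs₁ ++ z ∷ zs₂)
  length-insert []       = refl
  length-insert (_ ∷ zs) = cong suc (length-insert zs)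
  sub′ : ∀ {z} → z ∈ _ → z ∈ ys₁ ++ ys₂
  sub′ z∈xs with ∈-++⁻ ys₁ (sub (there z∈xs))
  ... | inj₁ p           = ∈-++⁺ˡ p
  ... | inj₂ (here refl) = ⊥-elim (All.lookup x∉xs z∈xs refl)
  ... | inj₂ (there p)   = ∈-++⁺ʳ ys₁ p

lookup-injective : Unique xs → ∀ {i j} → lookup xs i ≡ lookup xs j → i ≡ j
lookup-injective (_ ∷ _)  {Fin.zero}  {Fin.zero}  _  = refl
lookup-injective (x∉ ∷ _) {Fin.zero}  {Fin.suc j} eq = ⊥-elim (All.lookup x∉ (∈-lookup j) eq)
lookup-injective (x∉ ∷ _) {Fin.suc i} {Fin.zero}  eq = ⊥-elim (All.lookup x∉ (∈-lookup i) (sym eq))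
lookup-injective (_ ∷ u)  {Fin.suc i} {Fin.suc j} eq = cong Fin.suc (lookup-injective u eq)

Rotation : List A → List A → Set
Rotation xs ys = ∃₂ λ zs₁ zs₂ → xs ≡ zs₁ ++ zs₂ × ys ≡ zs₂ ++ zs₁

rotations-↭ : Star Rotation xs ys → xs ↭ ys
rotations-↭ ε                                = ↭-refl
rotations-↭ ((zs₁ , zs₂ , refl , refl) ◅ rs) = ↭-trans (++-comm zs₁ zs₂) (rotations-↭ rs)

rotate-to : x ∈ xs → ∃ λ zs → Rotation xs (x ∷ zs)
rotate-to x∈xs with ∈-∃++ x∈xs
... | zs₁ , zs₂ , refl = zs₂ ++ zs₁ , zs₁ , _ ∷ zs₂ , refl , refl

predecessor : ∀ (x y : A) zs → 3 ≤ length (x ∷ y ∷ zs) →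
              ∃₂ λ u rest → Rotation (x ∷ y ∷ zs) (u ∷ x ∷ y ∷ rest)
predecessor x y []       (s≤s (s≤s ()))
predecessor x y (z ∷ zs) _ with snoc-view z zs
... | rest , u , eq = u , rest , x ∷ y ∷ rest , [ u ] , cong (λ t → x ∷ y ∷ t) eq , refl

module DecEqList {A : Set} (_≟_ : DecidableEquality A) where

  count : A → List A → ℕ
  count x xs = length (filter (_≟ x) xs)

  count-++ : ∀ x xs ys → count x (xs ++ ys) ≡ count x xs + count x ys
  count-++ x xs ys = trans (cong length (filter-++ (_≟ x) xs ys)) (length-++ (filter (_≟ x) xs))

  count-↭ : xs ↭ ys → count x xs ≡ count x ys
  count-↭ p = ↭-length (filter-↭ (_≟ _) p)

  count-⊆ : xs ⊆ ys → count x xs ≤ count x ys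
  count-⊆ σ = length-mono-≤ (filter⁺ (_≟ _) (_≟ _) (λ { refl p → p }) σ)

  count-here : ∀ x xs → count x (x ∷ xs) ≡ suc (count x xs)
  count-here x xs = cong length (filter-accept (_≟ x) refl)

  count-there : y ≢ x → count x (y ∷ xs) ≡ count x xs
  count-there y≢x = cong length (filter-reject (_≟ _) y≢x)

  count-replicate-≡ : ∀ x t → count x (replicate t x) ≡ t
  count-replicate-≡ x zero    = refl
  count-replicate-≡ x (suc t) = trans (count-here x _) (cong suc (count-replicate-≡ x t))

  count-replicate-≢ : x ≢ y → ∀ t → count y (replicate t x) ≡ 0
  count-replicate-≢ x≢y zero    = refl
  count-replicate-≢ x≢y (suc t) = trans (count-there x≢y) (count-replicate-≢ x≢y t)

  count-pos⇒∈ : ∀ xs → 1 ≤ count x xs → x ∈ xs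
  count-pos⇒∈ {x} (y ∷ xs) h with y ≟ x
  ... | yes refl = here refl
  ... | no _     = there (count-pos⇒∈ xs h)

  ∈⇒count-pos : x ∈ xs → 1 ≤ count x xs
  ∈⇒count-pos x∈xs = filter-some (_≟ _) (Any.map sym x∈xs)

  ∉⇒count≡0 : x ∉ xs → count x xs ≡ 0
  ∉⇒count≡0 {x} {xs} x∉ =
    cong length (filter-none (_≟ x) (All.map (λ x≢e e≡x → x≢e (sym e≡x)) (All.¬Any⇒All¬ xs x∉)))

  unique⇒count≤1 : Unique xs → count x xs ≤ 1
  unique⇒count≤1 {xs} {x} u =
    unique-length-≤ {ys = [ x ]} (Unique.filter⁺ (_≟ x) u)
                    (λ z∈ → here (proj₂ (∈-filter⁻ (_≟ x) {xs = xs} z∈)))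

  count-pair≤length : x ≢ y → ∀ l → count x l + count y l ≤ length l
  count-pair≤length x≢y [] = z≤n
  count-pair≤length {x} {y} x≢y (e ∷ l) with e ≟ x | e ≟ y
  ... | yes refl | yes refl = ⊥-elim (x≢y refl)
  ... | yes refl | no _     = s≤s (count-pair≤length x≢y l)
  ... | no _     | yes refl = subst (_≤ suc (length l)) (sym (+-suc _ _)) (s≤s (count-pair≤length x≢y l))
  ... | no _     | no _     = m≤n⇒m≤1+n (count-pair≤length x≢y l)

  count-pair-cover : x ≢ y → ∀ l → length l ≤ count x l + count y l → All (λ e → e ≡ x ⊎ e ≡ y) l
  count-pair-cover x≢y [] _ = []
  count-pair-cover {x} {y} x≢y (e ∷ l) h with e ≟ x | e ≟ y
  ... | yes refl | yes refl = ⊥-elim (x≢y refl)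
  ... | yes refl | no _     = inj₁ refl ∷ count-pair-cover x≢y l (s≤s⁻¹ h)
  ... | no _     | yes refl =
    inj₂ refl ∷ count-pair-cover x≢y l (s≤s⁻¹ (subst (suc (length l) ≤_) (+-suc (count x l) (count y l)) h))
  ... | no _     | no _     = ⊥-elim (<-irrefl refl (<-≤-trans h (count-pair≤length x≢y l)))

  first-change : ∀ x xs → All (x ≡_) xs ⊎ ∃₂ λ C y → ∃ λ D → x ∷ xs ≡ C ++ x ∷ y ∷ D × x ≢ y
  first-change x []       = inj₁ []
  first-change x (y ∷ xs) with x ≟ y
  ... | no x≢y   = inj₂ ([] , y , xs , refl , x≢y)
  ... | yes refl with first-change x xs
  ...   | inj₁ all≡x                  = inj₁ (refl ∷ all≡x)
  ...   | inj₂ (C , z , D , eq , x≢z) = inj₂ (x ∷ C , z , D , cong (x ∷_) eq , x≢z)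

open module FinList {n} = DecEqList (FinP._≟_ {n})

-- The cycle of parts

n+m≢toℕ : ∀ {m} n (j : Fin m) → n + m ≢ toℕ j
n+m≢toℕ {m} n j eq = <-irrefl refl (<-≤-trans (FinP.toℕ<n j) (subst (m ≤_) eq (m≤n+m m n)))

CycSucc-functional : ∀ {m} {i j k : Fin m} → CycSucc i j → CycSucc i k → j ≡ k
CycSucc-functional     (inj₁ a) (inj₁ b) = FinP.toℕ-injective (trans a (sym b))
CycSucc-functional     (inj₁ a) (inj₂ b) = ⊥-elim (n+m≢toℕ _ _ (trans b (sym a)))
CycSucc-functional     (inj₂ a) (inj₁ b) = ⊥-elim (n+m≢toℕ _ _ (trans a (sym b)))
CycSucc-functional {m} (inj₂ a) (inj₂ b) = FinP.toℕ-injective (+-cancelʳ-≡ m _ _ (trans a (sym b)))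

CycSucc-injective : ∀ {m} {i j k : Fin m} → CycSucc i k → CycSucc j k → i ≡ j
CycSucc-injective (inj₁ a) (inj₁ b) = FinP.toℕ-injective (suc-injective (trans (sym a) b))
CycSucc-injective (inj₂ a) (inj₂ b) = FinP.toℕ-injective (suc-injective (trans (sym a) b))
CycSucc-injective {m} {i} {j} (inj₁ a) (inj₂ b) =
  ⊥-elim (n+m≢toℕ (toℕ i) j (suc-injective (trans (cong (_+ m) (sym a)) b)))
CycSucc-injective {m} {i} {j} (inj₂ a) (inj₁ b) =
  ⊥-elim (n+m≢toℕ (toℕ j) i (suc-injective (trans (cong (_+ m) (sym b)) a)))

CycSucc-compose : ∀ {m} {i j k : Fin m} → 2 ≤ m → CycSucc i j → CycSucc j k → CycPlus2 i k
CycSucc-compose     _ (inj₁ a) (inj₁ b) = inj₁ (trans b (cong suc a))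
CycSucc-compose     _ (inj₁ a) (inj₂ b) = inj₂ (trans b (cong suc a))
CycSucc-compose {m} _ (inj₂ a) (inj₁ b) = inj₂ (trans (cong (_+ m) b) (cong suc a))
CycSucc-compose {m} {i} {j} {k} 2≤m (inj₂ a) (inj₂ b) = ⊥-elim (<-irrefl refl (≤-trans 2≤m m≤1))
  where
  j≡0 : toℕ j ≡ 0
  j≡0 = n≤0⇒n≡0 (+-cancelʳ-≤ m (toℕ j) 0 (subst (_≤ m) (sym a) (FinP.toℕ<n i)))
  m≤1 : m ≤ 1
  m≤1 = subst (m ≤_) (trans b (cong suc j≡0)) (m≤n+m m (toℕ k))

CycSucc-irrefl : ∀ {m} {i : Fin m} → 2 ≤ m → ¬ CycSucc i i
CycSucc-irrefl         _   (inj₁ a) = 1+n≢n (sym a)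
CycSucc-irrefl {m} {i} 2≤m (inj₂ a) =
  <-irrefl (sym (+-cancelˡ-≡ (toℕ i) m 1 (trans a (sym (+-comm (toℕ i) 1))))) 2≤m

CycNeighbour-irrefl : ∀ {m} {i : Fin m} → 2 ≤ m → ¬ CycNeighbour i i
CycNeighbour-irrefl 2≤m = Sum.[ CycSucc-irrefl 2≤m , CycSucc-irrefl 2≤m ]

CycNeighbour-sym : ∀ {m} {i j : Fin m} → CycNeighbour i j → CycNeighbour j i
CycNeighbour-sym = Sum.swap

allFin-closed : ∀ n → ClosedWalk CycSucc (allFin (suc n))
allFin-closed n = linked-tabulate id (λ i → inj₁ (cong suc (sym (FinP.toℕ-inject₁ i))))
                                     (inj₂ (cong suc (sym (FinP.toℕ-fromℕ n))))

allFin-rotation : ∀ {m} (c : Fin m) → ∃ λ L → ClosedWalk CycSucc (c ∷ L) × c ∷ L ↭ allFin m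
allFin-rotation {suc n} c with ∈-∃++ (∈-allFin c)
... | A , B , eq = B ++ A , closed-rotate A (c ∷ B) (subst (ClosedWalk CycSucc) eq (allFin-closed n)) ,
                   ↭-trans (++-comm (c ∷ B) A) (↭-reflexive (sym eq))

directed-ring : ∀ {m} → 3 ≤ m → (c : Fin m) → ∃₂ λ n₁ n₂ → ∃ λ M →
                ClosedWalk CycSucc (c ∷ n₁ ∷ M ++ [ n₂ ]) × c ∷ n₁ ∷ M ++ [ n₂ ] ↭ allFin m
directed-ring 3≤m c with allFin-rotation c
... | L , closed , perm
  with ends {xs = L} (s≤s⁻¹ (subst (3 ≤_) (sym (trans (↭-length perm) (length-tabulate id))) 3≤m))
...   | n₁ , n₂ , M , refl = n₁ , n₂ , M , closed , perm

record Ring {m} (c : Fin m) (L : List (Fin m)) : Set where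
  field
    closed : ClosedWalk CycNeighbour (c ∷ L)
    perm   : c ∷ L ↭ allFin m

  unique : Unique (c ∷ L)
  unique = unique-↭ (↭-sym perm) (Unique.allFin⁺ m)

  complete : ∀ i → i ∈ c ∷ L
  complete i = ∈-resp-↭ (↭-sym perm) (∈-allFin i)

  length-ring : suc (length L) ≡ m
  length-ring = trans (↭-length perm) (length-tabulate id)

directed⇒ring : ∀ {m} {c : Fin m} {L} → ClosedWalk CycSucc (c ∷ L) → c ∷ L ↭ allFin m → Ring c L
directed⇒ring closed perm = record { closed = Linked.map inj₁ closed ; perm = perm }

ring-reverse : ∀ {m} {c : Fin m} {L} → Ring c L → Ring c (reverse L)
ring-reverse {c = c} {L} r = record
  { closed = subst (Linked CycNeighbour) reverse-cycle (linked-reverse CycNeighbour-sym (Ring.closed r))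
  ; perm   = ↭-trans (prep c (↭-reverse L)) (Ring.perm r)
  }
  where
  reverse-cycle : reverse (c ∷ L ++ [ c ]) ≡ c ∷ reverse L ++ [ c ]
  reverse-cycle = trans (unfold-reverse c (L ++ [ c ])) (cong (_++ [ c ]) (reverse-++ L [ c ]))

ring : ∀ {m} → 3 ≤ m → (c : Fin m) → ∃ (Ring c)
ring 3≤m c with directed-ring 3≤m c
... | n₁ , n₂ , M , closed , perm = n₁ ∷ M ++ [ n₂ ] , directed⇒ring closed perm

ring-through : ∀ {m} {c x y : Fin m} → 3 ≤ m → x ≢ c → y ≢ c → x ≢ y →
               ∃ λ L → Ring c L × x ∷ y ∷ [] ⊆ L
ring-through {c = c} {x} {y} 3≤m x≢c y≢c x≢y with ring 3≤m c
... | L , r with ⊆-order (∈-tail x≢c (Ring.complete r x)) (∈-tail y≢c (Ring.complete r y)) x≢y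
...   | inj₁ σ = L , r , σ
...   | inj₂ σ = reverse L , ring-reverse r , reverse⁺ σ

ring-from : ∀ {m} {c q : Fin m} → 3 ≤ m → CycNeighbour c q → ∃ λ L → Ring c (q ∷ L)
ring-from {c = c} 3≤m c~q with directed-ring 3≤m c
... | n₁ , n₂ , M , closed , perm with c~q
...   | inj₁ c→q rewrite CycSucc-functional c→q (Linked.head closed) =
  M ++ [ n₂ ] , directed⇒ring closed perm
...   | inj₂ q→c rewrite CycSucc-injective q→c (linked-last (c ∷ n₁ ∷ M) closed) =
  reverse (n₁ ∷ M) , subst (Ring c) (reverse-++ (n₁ ∷ M) [ n₂ ]) (ring-reverse (directed⇒ring closed perm))

neighbours : ∀ {m} → 3 ≤ m → (a : Fin m) →
             ∃₂ λ n₁ n₂ → CycSucc a n₁ × CycSucc n₂ a × Unique (a ∷ n₁ ∷ n₂ ∷ [])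
neighbours 3≤m a with directed-ring 3≤m a
... | n₁ , n₂ , M , closed , perm =
  n₁ , n₂ , Linked.head closed , linked-last (a ∷ n₁ ∷ M) closed ,
  unique-⊆ (refl ∷ refl ∷ ++⁺ˡ M (refl ∷ [])) (Ring.unique (directed⇒ring closed perm))

record Detour {m} (u q x y : Fin m) : Set where
  field
    path   : List (Fin m)
    linked : Linked CycNeighbour (u ∷ path ++ [ q ])
    simple : Unique path
    visits : x ∷ y ∷ [] ⊆ path

detour : ∀ {m} {u q x y : Fin m} → 4 ≤ m → CycNeighbour u q → x ≢ y → Detour u q x y
detour {m} {u} {q} {x} {y} 4≤m u~q x≢y = by-cases (x FinP.≟ u) (y FinP.≟ u) (y FinP.≟ q)
  where
  3≤m : 3 ≤ m
  3≤m = ≤-trans (n≤1+n 3) 4≤m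

  u≢q : u ≢ q
  u≢q refl = CycNeighbour-irrefl (≤-trans (n≤1+n 2) 3≤m) u~q

  around-u : ∀ {L} → Ring u L → x ∷ y ∷ [] ⊆ L ++ [ u ] → Detour u q x y
  around-u {L} r σ = record
    { path   = L ++ [ u ]
    ; linked = subst (λ t → Linked CycNeighbour (u ∷ t)) (sym (++-assoc L [ u ] [ q ]))
                     (linked-join (u ∷ L) [ q ] (Ring.closed r) (u~q ∷ [-]))
    ; simple = unique-↭ (∷↭∷ʳ u L) (Ring.unique r)
    ; visits = σ
    }

  around-q : ∀ {L} → Ring q L → x ∷ y ∷ [] ⊆ L → Detour u q x y
  around-q {L} r σ = record
    { path   = q ∷ L
    ; linked = u~q ∷ Ring.closed r
    ; simple = Ring.unique r
    ; visits = q ∷ʳ σ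
    }

  by-cases : Dec (x ≡ u) → Dec (y ≡ u) → Dec (y ≡ q) → Detour u q x y
  by-cases (no x≢u) (yes refl) _ with ring 3≤m u
  ... | L , r = around-u r (++⁺ (from∈ (∈-tail x≢u (Ring.complete r x))) (refl ∷ []))
  by-cases (no x≢u) (no y≢u) _ with ring-through 3≤m x≢u y≢u x≢y
  ... | L , r , σ = around-u r (++⁺ʳ [ u ] σ)
  by-cases (yes refl) _ (no y≢q) with ring-through 3≤m u≢q y≢q x≢y
  ... | L , r , σ = around-q r σ
  -- The walk u w u q y₂ q, with w and y₂ the other neighbours of u and q; they differ since m ≥ 4.
  by-cases (yes refl) _ (yes refl) with ring-from 3≤m u~q
  ... | L , r with ends {xs = L} (≤-pred (≤-pred (subst (4 ≤_) (sym (Ring.length-ring r)) 4≤m)))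
  ...   | y₂ , w , M , refl = record
    { path   = w ∷ u ∷ q ∷ y₂ ∷ []
    ; linked = CycNeighbour-sym w~u ∷ w~u ∷ u~q ∷ q~y₂ ∷ CycNeighbour-sym q~y₂ ∷ [-]
    ; simple = unique-⊆ (refl ∷ refl ∷ refl ∷ refl ∷ minimum M)
                        (unique-↭ (↭-sym (∷↭∷ʳ w (u ∷ q ∷ y₂ ∷ M))) (Ring.unique r))
    ; visits = w ∷ʳ refl ∷ refl ∷ y₂ ∷ʳ []
    }
    where
    w~u  = linked-last (u ∷ q ∷ y₂ ∷ M) (Ring.closed r)
    q~y₂ = Linked.head (Linked.tail (Ring.closed r))

-- Tours

record Tour {m} (s : Fin m → ℕ) (as : List (Fin m)) : Set where
  field
    walk    : List (Fin m)
    closed  : ClosedWalk CycNeighbour walk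
    visits  : as ⊆ walk
    bounded : ∀ i → count i walk ≤ s i

tour-rotate : ∀ {m} {s : Fin m → ℕ} xs {ys} → Tour s (xs ++ ys) → Tour s (ys ++ xs)
tour-rotate {s = s} xs t with ⊆-++-split xs (Tour.visits t)
... | W₁ , W₂ , eq , σ₁ , σ₂ = record
  { walk    = W₂ ++ W₁
  ; closed  = closed-rotate W₁ W₂ (subst (ClosedWalk CycNeighbour) eq (Tour.closed t))
  ; visits  = ++⁺ σ₂ σ₁
  ; bounded = λ i → subst (_≤ s i) (trans (cong (count i) eq) (count-↭ (++-comm W₁ W₂))) (Tour.bounded t i)
  }

tour-rotations : ∀ {m} {s : Fin m → ℕ} {xs ys} → Star Rotation xs ys → Tour s ys → Tour s xs
tour-rotations ε                              t = t
tour-rotations ((_ , zs₂ , refl , refl) ◅ rs) t = tour-rotate zs₂ (tour-rotations rs t)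

tour-root : ∀ {m} {s : Fin m → ℕ} {u rest} → Tour s (u ∷ rest) →
            ∃ λ T → ClosedWalk CycNeighbour (u ∷ T) × rest ⊆ T × (∀ i → count i (u ∷ T) ≤ s i)
tour-root {s = s} {u} t with ⊆-∷-split (Tour.visits t)
... | W₁ , W₂ , eq , σ =
  W₂ ++ W₁ ,
  closed-rotate W₁ (u ∷ W₂) (subst (ClosedWalk CycNeighbour) eq (Tour.closed t)) ,
  ++⁺ʳ W₁ σ ,
  λ i → subst (_≤ s i) (trans (cong (count i) eq) (count-↭ (++-comm W₁ (u ∷ W₂)))) (Tour.bounded t i)

-- The detour enters every part at most once, which the capacities lowered by one can afford.
tour-insert : ∀ {m} {s : Fin m → ℕ} {u x y rest} → 4 ≤ m → (∀ i → 1 ≤ s i) → x ≢ y →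
              Tour (pred ∘ s) (u ∷ rest) → Tour s (u ∷ x ∷ y ∷ rest)
tour-insert {s = s} {u} 4≤m positive x≢y t with tour-root t
... | T , closed , σ , bounded with snoc-uncons T u
...   | q , Z , eq = record
  { walk    = u ∷ path ++ T
  ; closed  = subst (λ t → Linked CycNeighbour (u ∷ t)) splice
                    (linked-join (u ∷ path) Z linked (Linked.tail closed′))
  ; visits  = refl ∷ ++⁺ visits σ
  ; bounded = λ i → subst (_≤ s i) (sym (count-split i)) (spare (unique⇒count≤1 simple) (bounded i) (positive i))
  }
  where
  closed′ : Linked CycNeighbour (u ∷ q ∷ Z)
  closed′ = subst (λ t → Linked CycNeighbour (u ∷ t)) eq closed
  open Detour (detour 4≤m (Linked.head closed′) x≢y)
  splice : path ++ q ∷ Z ≡ (path ++ T) ++ [ u ]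
  splice = trans (cong (path ++_) (sym eq)) (sym (++-assoc path T [ u ]))
  count-split : ∀ i → count i (u ∷ path ++ T) ≡ count i path + count i (u ∷ T)
  count-split i = trans (count-↭ (↭-sym (shift u path T))) (count-++ i path (u ∷ T))
  spare : ∀ {a b n} → a ≤ 1 → b ≤ pred n → 1 ≤ n → a + b ≤ n
  spare {n = suc n} a≤1 b≤n _ = +-mono-≤ a≤1 b≤n

triangle-tour : ∀ {m} {s : Fin m → ℕ} {a b c} → 3 ≤ m → (∀ i → 1 ≤ s i) →
                a ≢ b → b ≢ c → a ≢ c → Tour s (a ∷ b ∷ c ∷ [])
triangle-tour 3≤m positive a≢b b≢c a≢c with ring-through 3≤m (a≢b ∘ sym) (a≢c ∘ sym) b≢c
... | L , r , σ = record
  { walk    = _ ∷ L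
  ; closed  = Ring.closed r
  ; visits  = refl ∷ σ
  ; bounded = λ i → ≤-trans (unique⇒count≤1 (Ring.unique r)) (positive i)
  }

spokes : ∀ {m} → Fin m → List (Fin m) → List (Fin m)
spokes a []      = []
spokes a (n ∷ N) = a ∷ n ∷ spokes a N

linked-spokes : ∀ {m} {a : Fin m} {N} → All (CycNeighbour a) N → Linked CycNeighbour (spokes a N ++ [ a ])
linked-spokes []                 = [-]
linked-spokes (a~n ∷ [])         = a~n ∷ CycNeighbour-sym a~n ∷ [-]
linked-spokes (a~n ∷ ns@(_ ∷ _)) = a~n ∷ CycNeighbour-sym a~n ∷ linked-spokes ns

spokes-closed : ∀ {m} {a : Fin m} {N} → All (CycNeighbour a) N → ClosedWalk CycNeighbour (spokes a N)
spokes-closed []         = tt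
spokes-closed (a~n ∷ ns) = linked-spokes (a~n ∷ ns)

spokes-↭ : ∀ {m} (a : Fin m) N → spokes a N ↭ replicate (length N) a ++ N
spokes-↭ a []      = ↭-refl
spokes-↭ a (n ∷ N) = prep a (↭-trans (prep n (spokes-↭ a N)) (↭-sym (shift n (replicate (length N) a) N)))

spokes-visits : ∀ {m} (a : Fin m) N → replicate (length N) a ⊆ spokes a N
spokes-visits a []      = []
spokes-visits a (n ∷ N) = refl ∷ (n ∷ʳ spokes-visits a N)

split-≤ : ∀ {r} A B → r ≤ A + B → ∃₂ λ t u → t + u ≡ r × t ≤ A × u ≤ B
split-≤ {zero}  _       _ _       = 0 , 0 , refl , z≤n , z≤n
split-≤ {suc r} zero    _ r≤B     = 0 , suc r , refl , z≤n , r≤B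
split-≤ {suc r} (suc A) B (s≤s h) with split-≤ A B h
... | t , u , refl , t≤A , u≤B = suc t , u , refl , s≤s t≤A , u≤B

constant-tour : ∀ {m} {s : Fin m → ℕ} {a} r → 3 ≤ m → (∀ i j → CycPlus2 i j → r ≤ s i + s j) → r ≤ s a →
                Tour s (replicate r a)
constant-tour {s = s} {a} r 3≤m pairs r≤sa with neighbours 3≤m a
... | n₁ , n₂ , a→n₁ , n₂→a , (a≢n₁ ∷ a≢n₂ ∷ []) ∷ (n₁≢n₂ ∷ []) ∷ [] ∷ []
  with split-≤ (s n₁) (s n₂)
         (subst (r ≤_) (+-comm (s n₂) (s n₁)) (pairs n₂ n₁ (CycSucc-compose (≤-trans (n≤1+n 2) 3≤m) n₂→a a→n₁)))
... | t , u , refl , t≤ , u≤ = record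
  { walk    = spokes a N
  ; closed  = spokes-closed (All.++⁺ (All.replicate⁺ t (inj₁ a→n₁)) (All.replicate⁺ u (inj₂ n₂→a)))
  ; visits  = subst (λ l → replicate l a ⊆ spokes a N) length-N (spokes-visits a N)
  ; bounded = λ i → subst (_≤ s i) (sym (count-spokes i)) (by-part i)
  }
  where
  N₁ = replicate t n₁
  N₂ = replicate u n₂
  N  = N₁ ++ N₂

  length-N : length N ≡ t + u
  length-N = trans (length-++ N₁) (cong₂ _+_ (length-replicate t) (length-replicate u))

  count-spokes : ∀ i → count i (spokes a N) ≡ count i (replicate (t + u) a) + (count i N₁ + count i N₂)
  count-spokes i = trans (count-↭ (spokes-↭ a N))
                   (trans (count-++ i (replicate (length N) a) N)
                          (cong₂ _+_ (cong (λ l → count i (replicate l a)) length-N) (count-++ i N₁ N₂)))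

  by-part : ∀ i → count i (replicate (t + u) a) + (count i N₁ + count i N₂) ≤ s i
  by-part i with a FinP.≟ i | n₁ FinP.≟ i | n₂ FinP.≟ i
  ... | yes refl | _ | _
    rewrite count-replicate-≡ a (t + u) | count-replicate-≢ (a≢n₁ ∘ sym) t | count-replicate-≢ (a≢n₂ ∘ sym) u
    = subst (_≤ s a) (sym (+-identityʳ (t + u))) r≤sa
  ... | no a≢i | yes refl | _
    rewrite count-replicate-≢ a≢i (t + u) | count-replicate-≡ n₁ t | count-replicate-≢ (n₁≢n₂ ∘ sym) u
    = subst (_≤ s n₁) (sym (+-identityʳ t)) t≤
  ... | no a≢i | no n₁≢i | yes refl
    rewrite count-replicate-≢ a≢i (t + u) | count-replicate-≢ n₁≢i t | count-replicate-≡ n₂ u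
    = u≤
  ... | no a≢i | no n₁≢i | no n₂≢i
    rewrite count-replicate-≢ a≢i (t + u) | count-replicate-≢ n₁≢i t | count-replicate-≢ n₂≢i u
    = z≤n

-- Choosing the pair to remove

data Shape {m} (s : Fin m → ℕ) (S : List (Fin m)) : Set where
  constant  : ∀ {a r} → S ≡ replicate r a → Shape s S
  triangle  : ∀ {a b c} → Star Rotation S (a ∷ b ∷ c ∷ []) → a ≢ b → b ≢ c → a ≢ c → Shape s S
  reducible : ∀ {u x y rest} → Star Rotation S (u ∷ x ∷ y ∷ rest) → x ≢ y →
              (∀ i → i ≢ x → i ≢ y → count i S < s i) → Shape s S

2*suc : ∀ k → 2 * suc k + 1 ≡ suc (suc (2 * k + 1))
2*suc k = cong (λ n → suc (n + 1)) (+-suc k (k + 0))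

module Selection {m} {s : Fin m → ℕ} {k} (large : ∀ i → suc k ≤ s i) (a : Fin m) (as : List (Fin m))
                 (length-S : length (a ∷ as) ≡ 2 * suc k + 1) where

  S : List (Fin m)
  S = a ∷ as

  Full : Fin m → Set
  Full i = s i ≤ count i S

  full? : ∀ i → Dec (Full i)
  full? i = s i ≤? count i S

  full⇒∈ : ∀ {i} → Full i → i ∈ S
  full⇒∈ {i} f = count-pos⇒∈ S (≤-trans (s≤s z≤n) (≤-trans (large i) f))

  ∈-after : ∀ {T i} → Star Rotation S T → i ∈ S → i ∈ T
  ∈-after R = ∈-resp-↭ (rotations-↭ R)

  ∈-before : ∀ {T i} → Star Rotation S T → i ∈ T → i ∈ S
  ∈-before R = ∈-resp-↭ (↭-sym (rotations-↭ R))

  length-after : ∀ {T} → Star Rotation S T → length T ≡ 2 * suc k + 1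
  length-after R = trans (sym (↭-length (rotations-↭ R))) length-S

  3≤length-after : ∀ {T} → Star Rotation S T → 3 ≤ length T
  3≤length-after R = subst (3 ≤_) (sym (trans (length-after R) (2*suc k))) (s≤s (s≤s (m≤n+m 1 (2 * k))))

  reduce-at : ∀ {x y zs} → Star Rotation S (x ∷ y ∷ zs) → x ≢ y → (∀ i → Full i → i ≡ x ⊎ i ≡ y) → Shape s S
  reduce-at {x} {y} {zs} R x≢y covers with predecessor x y zs (3≤length-after R)
  ... | u , rest , rot =
    reducible (R ◅◅ rot ◅ ε) x≢y (λ i i≢x i≢y → ≰⇒> (λ f → Sum.[ i≢x , i≢y ] (covers i f)))

  one-full : ∀ {b z} → b ∈ S → a ≢ b → Full z → (∀ i → Full i → i ≡ z) → Shape s S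
  one-full {z = z} b∈S a≢b f only with rotate-to (full⇒∈ f)
  ... | l , rot with first-change z l
  ...   | inj₁ all≡z = ⊥-elim (a≢b (trans (≡z (here refl)) (sym (≡z b∈S))))
    where
    ≡z : ∀ {e} → e ∈ S → e ≡ z
    ≡z e∈S = all-≡-∈ all≡z (∈-after (rot ◅ ε) e∈S)
  ...   | inj₂ (C , y , D , eq , z≢y) =
    reduce-at (rot ◅ (C , _ , eq , refl) ◅ ε) z≢y (λ i f → inj₁ (only i f))

  -- Two full parts occur at least k + 1 times each among the 2k + 3 entries of S, so at most one entry w
  -- lies outside them, and a third full part can only be w, which forces k = 0.
  module _ {w z₁ z₂} (w∈S : w ∈ S) (w-out : ¬ (w ≡ z₁ ⊎ w ≡ z₂))
           (f₁ : Full z₁) (f₂ : Full z₂) (z₁≢z₂ : z₁ ≢ z₂) where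

    w≢z₁ : w ≢ z₁
    w≢z₁ = w-out ∘ inj₁

    w≢z₂ : w ≢ z₂
    w≢z₂ = w-out ∘ inj₂

    ∈-rest : ∀ {l z} → Star Rotation S (w ∷ l) → Full z → w ≢ z → z ∈ l
    ∈-rest R f w≢z = ∈-tail (w≢z ∘ sym) (∈-after R (full⇒∈ f))

    length-rest : ∀ {l} → Star Rotation S (w ∷ l) → length l ≡ 2 * suc k
    length-rest R = suc-injective (trans (length-after R) (+-comm (2 * suc k) 1))

    rest-in-pair : ∀ {l} → Star Rotation S (w ∷ l) → All (λ e → e ≡ z₁ ⊎ e ≡ z₂) l
    rest-in-pair {l} R = count-pair-cover z₁≢z₂ l (begin
      length l                  ≡⟨ length-rest R ⟩
      suc k + (suc k + 0)       ≤⟨ +-mono-≤ (large z₁) (≤-trans (≤-reflexive (+-identityʳ (suc k))) (large z₂)) ⟩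
      s z₁ + s z₂               ≤⟨ +-mono-≤ f₁ f₂ ⟩
      count z₁ S + count z₂ S   ≡⟨ cong₂ _+_ (count-rest w≢z₁) (count-rest w≢z₂) ⟩
      count z₁ l + count z₂ l   ∎)
      where
      open ≤-Reasoning
      count-rest : ∀ {z} → w ≢ z → count z S ≡ count z l
      count-rest w≢z = trans (count-↭ (rotations-↭ R)) (count-there w≢z)

    triangle-case : ∀ {l} → Star Rotation S (w ∷ l) → length l ≡ 2 → Shape s S
    triangle-case {e₁ ∷ e₂ ∷ []} R _ =
      triangle R (w-out ∘ in-pair (here refl)) e₁≢e₂ (w-out ∘ in-pair (there (here refl)))
      where
      in-pair : ∀ {e} → e ∈ e₁ ∷ e₂ ∷ [] → w ≡ e → w ≡ z₁ ⊎ w ≡ z₂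
      in-pair e∈ refl = All.lookup (rest-in-pair R) e∈
      e₁≢e₂ : e₁ ≢ e₂
      e₁≢e₂ refl = z₁≢z₂ (trans (all-≡-∈ (refl ∷ []) (∈-rest R f₁ w≢z₁))
                                (sym (all-≡-∈ (refl ∷ []) (∈-rest R f₂ w≢z₂))))

    change-case : ∀ {l} → Star Rotation S (w ∷ l) → ¬ Full w → Shape s S
    change-case {[]}    R _   with () ← ∈-rest R f₁ w≢z₁
    change-case {e ∷ l} R ¬fw with first-change e l
    ... | inj₁ all≡e =
      ⊥-elim (z₁≢z₂ (trans (all-≡-∈ all≡e (∈-rest R f₁ w≢z₁)) (sym (all-≡-∈ all≡e (∈-rest R f₂ w≢z₂)))))
    ... | inj₂ (C , y , D , eq , e≢y) =
      reduce-at (R ◅◅ (w ∷ C , e ∷ y ∷ D , cong (w ∷_) eq , refl) ◅ ε) e≢y covers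
      where
      in-pair = rest-in-pair R
      covers : ∀ i → Full i → i ≡ e ⊎ i ≡ y
      covers i f with ∈-after R (full⇒∈ f)
      ... | here refl = ⊥-elim (¬fw f)
      ... | there i∈l = one-of-two (All.lookup in-pair (here refl))
                                   (All.lookup in-pair (subst (y ∈_) (sym eq) (∈-++⁺ʳ C (there (here refl)))))
                                   e≢y (All.lookup in-pair i∈l)

    outsider : Shape s S
    outsider with rotate-to w∈S
    ... | l , rot with full? w
    ...   | no ¬fw = change-case (rot ◅ ε) ¬fw
    ...   | yes fw = triangle-case (rot ◅ ε) (trans (length-rest (rot ◅ ε)) (cong (λ n → 2 * suc n) k≡0))
      where
      k≡0 : k ≡ 0
      k≡0 = n≤0⇒n≡0 (s≤s⁻¹ (begin
        suc k            ≤⟨ large w ⟩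
        s w              ≤⟨ fw ⟩
        count w S        ≡⟨ count-↭ (rotations-↭ (rot ◅ ε)) ⟩
        count w (w ∷ l)  ≡⟨ count-here w l ⟩
        suc (count w l)  ≡⟨ cong suc (∉⇒count≡0 (w-out ∘ All.lookup (rest-in-pair (rot ◅ ε)))) ⟩
        1                ∎))
        where open ≤-Reasoning

  in-pair? : ∀ (z₁ z₂ e : Fin m) → Dec (e ≡ z₁ ⊎ e ≡ z₂)
  in-pair? z₁ z₂ e = e FinP.≟ z₁ ⊎-dec e FinP.≟ z₂

  two-full : ∀ {b zs z₁ z₂} → Star Rotation S (a ∷ b ∷ zs) → a ≢ b →
             Full z₁ → Full z₂ → z₁ ≢ z₂ → Shape s S
  two-full {z₁ = z₁} {z₂} R a≢b f₁ f₂ z₁≢z₂ with All.all? (in-pair? z₁ z₂) S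
  ... | yes in-pair = reduce-at R a≢b (λ i f → one-of-two (All.lookup in-pair (here refl))
                                                          (All.lookup in-pair (∈-before R (there (here refl))))
                                                          a≢b (All.lookup in-pair (full⇒∈ f)))
  ... | no ¬in-pair =
    let w , w∈S , w-out = find (All.¬All⇒Any¬ (in-pair? z₁ z₂) S ¬in-pair)
    in  outsider w∈S w-out f₁ f₂ z₁≢z₂

  with-change : ∀ {b zs} → Star Rotation S (a ∷ b ∷ zs) → a ≢ b → Shape s S
  with-change R a≢b with FinP.any? full?
  ... | no none = reduce-at R a≢b (λ i f → ⊥-elim (none (i , f)))
  ... | yes (z₁ , f₁) with FinP.any? (λ i → ¬? (i FinP.≟ z₁) ×-dec full? i)
  ...   | no one = one-full (∈-before R (there (here refl))) a≢b f₁
                            (λ i f → decidable-stable (i FinP.≟ z₁) (λ i≢z₁ → one (i , i≢z₁ , f)))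
  ...   | yes (z₂ , z₂≢z₁ , f₂) = two-full R a≢b f₁ f₂ (z₂≢z₁ ∘ sym)

  shape : Shape s S
  shape with first-change a as
  ... | inj₁ all≡a                  = constant (all-≡-replicate all≡a)
  ... | inj₂ (C , b , D , eq , a≢b) = with-change ((C , _ , eq , refl) ◅ ε) a≢b

-- The induction

record Capacity {m} (k : ℕ) (s : Fin m → ℕ) : Set where
  field
    each  : ∀ i → k ≤ s i
    pairs : ∀ i j → CycPlus2 i j → 2 * k + 1 ≤ s i + s j

capacity-pred : ∀ {m} {k} {s : Fin m → ℕ} → Capacity (suc k) s → Capacity k (pred ∘ s)
capacity-pred {k = k} {s} cap = record
  { each  = λ i → pred-mono-≤ (each i)
  ; pairs = λ i j p → pred-sum (subst (_≤ s i + s j) (2*suc k) (pairs i j p)) (each i) (each j)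
  }
  where
  open Capacity cap
  pred-sum : ∀ {n a b} → suc (suc n) ≤ a + b → suc k ≤ a → suc k ≤ b → n ≤ pred a + pred b
  pred-sum {n} {suc a} {suc b} h _ _ = s≤s⁻¹ (subst (suc n ≤_) (+-suc a b) (s≤s⁻¹ h))

reduced-bound : ∀ {m} {s : Fin m → ℕ} {S u x y rest} → Star Rotation S (u ∷ x ∷ y ∷ rest) →
                (∀ i → count i S ≤ s i) → (∀ i → i ≢ x → i ≢ y → count i S < s i) →
                ∀ i → count i (u ∷ rest) ≤ pred (s i)
reduced-bound {s = s} {S} {u} {x} {y} {rest} R bound spare i = by-cases (i FinP.≟ x) (i FinP.≟ y)
  where
  split : count i S ≡ count i (x ∷ y ∷ []) + count i (u ∷ rest)
  split = trans (count-↭ (↭-trans (rotations-↭ R) (shifts [ u ] (x ∷ y ∷ []))))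
                (count-++ i (x ∷ y ∷ []) (u ∷ rest))

  drop-one : i ∈ x ∷ y ∷ [] → count i (u ∷ rest) ≤ pred (s i)
  drop-one i∈ = pred-mono-≤ (≤-trans (+-monoˡ-≤ (count i (u ∷ rest)) (∈⇒count-pos i∈))
                                     (subst (_≤ s i) split (bound i)))

  by-cases : Dec (i ≡ x) → Dec (i ≡ y) → count i (u ∷ rest) ≤ pred (s i)
  by-cases (yes refl) _          = drop-one (here refl)
  by-cases (no _)     (yes refl) = drop-one (there (here refl))
  by-cases (no i≢x)   (no i≢y)   =
    pred-mono-≤ (subst (_< s i) (trans split (cong (_+ _) (∉⇒count≡0 not-here))) (spare i i≢x i≢y))
    where
    not-here : i ∉ x ∷ y ∷ []
    not-here (here i≡x)         = i≢x i≡x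
    not-here (there (here i≡y)) = i≢y i≡y

tour : ∀ k {m} → 4 ≤ m → {s : Fin m → ℕ} → Capacity k s →
       ∀ as → length as ≡ 2 * k + 1 → (∀ i → count i as ≤ s i) → Tour s as
tour zero 4≤m cap (a ∷ []) _ bound =
  constant-tour 1 (≤-trans (n≤1+n 3) 4≤m) (Capacity.pairs cap) (subst (_≤ _) (count-here a []) (bound a))
tour (suc k) {m} 4≤m {s} cap (a ∷ as) length-as bound = by-shape (Selection.shape (Capacity.each cap) a as length-as)
  where
  3≤m : 3 ≤ m
  3≤m = ≤-trans (n≤1+n 3) 4≤m
  positive : ∀ i → 1 ≤ s i
  positive i = ≤-trans (s≤s z≤n) (Capacity.each cap i)

  by-shape : Shape s (a ∷ as) → Tour s (a ∷ as)
  by-shape (constant {b} {r} eq) =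
    subst (Tour s) (sym eq) (constant-tour r 3≤m (λ i j p → subst (_≤ s i + s j) length-r (Capacity.pairs cap i j p))
                                              (subst (_≤ s b) count-b (bound b)))
    where
    count-b : count b (a ∷ as) ≡ r
    count-b = trans (cong (count b) eq) (count-replicate-≡ b r)
    length-r : 2 * suc k + 1 ≡ r
    length-r = trans (sym length-as) (trans (cong length eq) (length-replicate r))
  by-shape (triangle R a≢b b≢c a≢c) = tour-rotations R (triangle-tour 3≤m positive a≢b b≢c a≢c)
  by-shape (reducible {u} {x} {y} {rest} R x≢y spare) =
    tour-rotations R (tour-insert 4≤m positive x≢y
      (tour k 4≤m (capacity-pred cap) (u ∷ rest) length-reduced (reduced-bound R bound spare)))
    where
    length-reduced : length (u ∷ rest) ≡ 2 * k + 1
    length-reduced =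
      suc-injective (suc-injective (trans (sym (↭-length (rotations-↭ R))) (trans length-as (2*suc k))))

-- Choosing the vertices

module Realisation {n m} (p : Fin n → Fin m) where

  open import Data.List.Membership.DecPropositional (FinP._≟_ {n}) using (_∈?_)

  in-part? : ∀ i v → Dec (p v ≡ i)
  in-part? i v = p v FinP.≟ i

  count-map : ∀ i X → count i (map p X) ≡ length (filter (in-part? i) X)
  count-map i []      = refl
  count-map i (v ∷ X) with p v FinP.≟ i
  ... | yes _ = cong suc (count-map i X)
  ... | no _  = count-map i X

  count-map-≤ : ∀ {X} → Unique X → ∀ i → count i (map p X) ≤ partSize p i
  count-map-≤ {X} u i = subst (_≤ partSize p i) (sym (count-map i X))
    (unique-length-≤ (Unique.filter⁺ (in-part? i) u) λ v∈ →
       ∈-filter⁺ (in-part? i) (∈-allFin _) (proj₂ (∈-filter⁻ (in-part? i) {xs = X} v∈)))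

  fresh : ∀ {X i} → Unique X → count i (map p X) < partSize p i → ∃ λ v → p v ≡ i × v ∉ X
  fresh {X} {i} u h with FinP.any? (λ v → in-part? i v ×-dec ¬? (v ∈? X))
  ... | yes found = found
  ... | no none   = ⊥-elim (<-irrefl refl (<-≤-trans h (subst (partSize p i ≤_) (sym (count-map i X)) covered)))
    where
    covered : partSize p i ≤ length (filter (in-part? i) X)
    covered = unique-length-≤ (Unique.filter⁺ (in-part? i) (Unique.allFin⁺ n)) λ {v} v∈ →
      let pv≡i = proj₂ (∈-filter⁻ (in-part? i) {xs = allFin n} v∈) in
      ∈-filter⁺ (in-part? i) (decidable-stable (v ∈? X) (λ v∉ → none (v , pv≡i , v∉))) pv≡i

  count-move : ∀ i U v W → count i (map p (U ++ [ v ])) + count i W ≡ count i (map p U) + count i (p v ∷ W)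
  count-move i U v W = begin
    count i (map p (U ++ [ v ])) + count i W
      ≡⟨ cong (λ l → count i l + count i W) (map-++ p U [ v ]) ⟩
    count i (map p U ++ [ p v ]) + count i W
      ≡⟨ cong (_+ count i W) (count-++ i (map p U) [ p v ]) ⟩
    count i (map p U) + count i [ p v ] + count i W
      ≡⟨ +-assoc (count i (map p U)) _ _ ⟩
    count i (map p U) + (count i [ p v ] + count i W)
      ≡⟨ cong (count i (map p U) +_) (sym (count-++ i [ p v ] W)) ⟩
    count i (map p U) + count i (p v ∷ W)
      ∎
    where open ≡-Reasoning

  room : ∀ U {vs w W} → map p vs ⊆ W → count w (map p U) + count w (w ∷ W) ≤ partSize p w →
         count w (map p (U ++ vs)) < partSize p w
  room U {vs} {w} {W} σ bound = begin-strict
    count w (map p (U ++ vs))              ≡⟨ trans (cong (count w) (map-++ p U vs)) (count-++ w (map p U) (map p vs)) ⟩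
    count w (map p U) + count w (map p vs) ≤⟨ +-monoʳ-≤ (count w (map p U)) (count-⊆ σ) ⟩
    count w (map p U) + count w W          <⟨ +-monoʳ-< (count w (map p U)) (n<1+n (count w W)) ⟩
    count w (map p U) + suc (count w W)    ≡⟨ cong (count w (map p U) +_) (sym (count-here w W)) ⟩
    count w (map p U) + count w (w ∷ W)    ≤⟨ bound ⟩
    partSize p w                           ∎
    where open ≤-Reasoning

  -- U holds the vertices placed so far, vs the required vertices still to be placed along W.
  realise : ∀ U vs W → map p vs ⊆ W → Unique (U ++ vs) →
            (∀ i → count i (map p U) + count i W ≤ partSize p i) →
            ∃ λ VW → map p VW ≡ W × vs ⊆ VW × Unique (U ++ VW)
  realise U []       []      []       u _ = [] , refl , [] , u
  realise U vs       (w ∷ W) (_ ∷ʳ σ) u bound with fresh u (room U σ (bound w))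
  ... | f , refl , f∉
    with realise (U ++ [ f ]) vs W σ
                 (subst Unique (sym (++-assoc U [ f ] vs)) (unique-↭ (↭-sym (shift f U vs)) (All.¬Any⇒All¬ _ f∉ ∷ u)))
                 (λ i → subst (_≤ partSize p i) (sym (count-move i U f W)) (bound i))
  ...   | VW , refl , τ , u′ = f ∷ VW , refl , f ∷ʳ τ , subst Unique (++-assoc U [ f ] VW) u′
  realise U (v ∷ vs) (w ∷ W) (refl ∷ σ) u bound
    with realise (U ++ [ v ]) vs W σ (subst Unique (sym (++-assoc U [ v ] vs)) u)
                 (λ i → subst (_≤ partSize p i) (sym (count-move i U v W)) (bound i))
  ... | VW , refl , τ , u′ = v ∷ VW , refl , refl ∷ τ , subst Unique (++-assoc U [ v ] VW) u′

  lift-tour : ∀ {G : SimpleGraph n} → (∀ u w → CycNeighbour (p u) (p w) → Adj G u w) →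
              ∀ {vs} → Unique vs → Tour (partSize p) (map p vs) →
              ∃ λ W → ClosedWalk (Adj G) W × Unique W × vs ⊆ W
  lift-tour adjacent {vs} u t with realise [] vs (Tour.walk t) (Tour.visits t) u (Tour.bounded t)
  ... | W , refl , σ , unique-W = W , closed-pullback (λ {a} {b} → adjacent a b) W (Tour.closed t) , unique-W , σ

linked-lookup : ∀ xs {z} → Linked R (xs ++ [ z ]) →
                ∀ i j → toℕ j ≡ suc (toℕ i) → R (lookup xs i) (lookup xs j)
linked-lookup (_ ∷ _ ∷ _)  (r ∷ _) Fin.zero    (Fin.suc Fin.zero) _ = r
linked-lookup (_ ∷ x ∷ xs) (_ ∷ l) (Fin.suc i) (Fin.suc j)        e =
  linked-lookup (x ∷ xs) l i j (suc-injective e)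

linked-lookup-last : ∀ xs {z} → Linked R (xs ++ [ z ]) → ∀ i → suc (toℕ i) ≡ length xs → R (lookup xs i) z
linked-lookup-last (_ ∷ [])     (r ∷ _) Fin.zero    _ = r
linked-lookup-last (_ ∷ x ∷ xs) (_ ∷ l) (Fin.suc i) e = linked-lookup-last (x ∷ xs) l i (suc-injective e)

closed-lookup : ∀ xs → ClosedWalk R xs → ∀ i j → CycSucc i j → R (lookup xs i) (lookup xs j)
closed-lookup xs@(_ ∷ _) c i j           (inj₁ e) = linked-lookup xs c i j e
closed-lookup xs@(_ ∷ _) c i Fin.zero    (inj₂ e) = linked-lookup-last xs c i (sym e)
closed-lookup xs@(_ ∷ _) c i (Fin.suc j) (inj₂ e) = ⊥-elim (n+m≢toℕ (toℕ j) i (suc-injective e))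

ordered-cycle : ∀ {n r} {G : SimpleGraph n} (v : Fin r → Fin n) → 3 ≤ r → ∀ W →
                ClosedWalk (Adj G) W → Unique W → tabulate v ⊆ W → Σ (Cycle G) λ C → ContainsInOrder C v
ordered-cycle {r = r} {G} v 3≤r W closed unique σ =
  cycle , position , (λ j → trans (lookup-embed σ (index j)) (lookup-tabulate v j)) ,
  (λ i j i<j → embed-mono σ (subst₂ _<_ (sym (FinP.toℕ-cast _ i)) (sym (FinP.toℕ-cast _ j)) i<j))
  where
  cycle : Cycle G
  cycle = record
    { len      = length W
    ; len≥3    = ≤-trans 3≤r (subst (_≤ length W) (length-tabulate v) (length-mono-≤ σ))
    ; vert     = lookup W
    ; distinct = lookup-injective unique
    ; edges    = closed-lookup W closed
    }
  index : Fin r → Fin (length (tabulate v))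
  index = cast (sym (length-tabulate v))
  position : Fin r → Fin (length W)
  position j = embed σ (index j)

theorem2p4 : ∀ (k : ℕ) → 1 ≤ k → ∀ (n m : ℕ) → 4 ≤ m →
    (G : SimpleGraph n) → (p : Fin n → Fin m) → IsBraceletPartition m G p →
    (∀ (i : Fin m) → k ≤ partSize p i) →
    (∀ (i j : Fin m) → CycPlus2 i j → 2 * k + 1 ≤ partSize p i + partSize p j) →
    IsOrdered (2 * k + 1) G
theorem2p4 k 1≤k n m 4≤m G p (_ , _ , adjacency) sizes pairs v v-injective =
  let W , closed , unique-W , σ = lift-tour {G = G} (λ u w → proj₂ (adjacency u w)) unique-v part-tour
  in ordered-cycle v (+-monoˡ-≤ 1 (*-monoʳ-≤ 2 1≤k)) W closed unique-W σ
  where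
  open Realisation p
  unique-v : Unique (tabulate v)
  unique-v = Unique.tabulate⁺ v-injective
  part-tour : Tour (partSize p) (map p (tabulate v))
  part-tour = tour k 4≤m (record { each = sizes ; pairs = pairs }) (map p (tabulate v))
                   (trans (length-map p (tabulate v)) (length-tabulate v)) (count-map-≤ unique-v)
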